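{- Let $k\ge 1$, $d\ge k$, $\nu\ge d$ be integers and $(y,x)\in\mathbb{N}^{\nu+1}\times\mathbb{N}^{d+1}$, with $y=(y_0,\ldots,y_\nu)$, $x=(x_0,\ldots,x_d)$. Then $(y,x)$ is the representative vector of a regular $(N,D)\in\Delta(\nu,d,k)$ if and only if $y_\nu>0$ and $$\sum_{i=h}^{\nu-k+h}\binom{\nu-k}{i-h}y_i=\sum_{i=h}^{d}\binom{\nu-k}{i-h}x_i\qquad\text{for all } h\in\{0,\ldots,k\}.$$ When this holds, $R^*(N,D)=y_\nu$ and $$R(N,D)=\sum_{i=0}^\nu\binom{\nu}{i}y_i=\sum_{i=0}^d\binom{\nu}{i}x_i=\frac12\Big(\sum_{i=0}^\nu\binom{\nu}{i}y_i+\sum_{i=0}^d\binom{\nu}{i}x_i\Big).$$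
   Context: Binomial coefficients $\binom{n}{m}$ are $0$ when $m<0$ or $m>n$. $\Delta(\nu,d,k)$ is the set of pairs $(N,D)$ of arrays (finite sequences of rows) with $\nu$ columns over $\{0,1\}$ such that: $N$ contains at least one all-ones row; each row of $D$ has at most $d$ non-zero coordinates; and for every choice of $k$ columns, extracting them from $N$ and from $D$ gives the same array up to the order of rows. $R^*(N,D)$ is the number of all-ones rows in $N$ and $R(N,D)$ the number of rows of $D$. The weight of a Boolean word is its number of non-zero coordinates. An array with rows in $\{0,1\}^\nu$ is regular if for each $i$ all words of weight $i$ occur in it with the same frequency; $(N,D)$ is regular if $N$ and $D$ are. The representative vector of a regular $(N,D)$ is $(y,x)\in\mathbb{N}^{\nu+1}\times\mathbb{N}^{d+1}$ where, for $i\in\{0,\ldots,\nu\}$, $y_i$ is the number of times each word of length $\nu$ and weight $i$ occurs in $N$, and, for $i\le d$, $x_i$ is the number of times each such word occurs in $D$. -}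

module Defs where

open import Data.Bool using (Bool; true; false; if_then_else_)
open import Data.Bool.Properties using () renaming (_≟_ to _≟ᵇ_)
open import Data.Nat using (ℕ; zero; suc; _+_; _*_; _∸_; _≤_; _≤ᵇ_)
open import Data.Nat.Combinatorics using (_C_)
open import Data.Fin using (Fin; toℕ)
open import Data.Vec using (Vec; []; _∷_; replicate)
open import Data.Vec.Properties using (≡-dec)
open import Data.List using (List; []; _∷_; length; filter; map; allFin)
open import Data.Nat.ListAction using (sum)
open import Data.List.Membership.Propositional using (_∈_)
open import Data.List.Relation.Unary.All using (All)
open import Data.List.Relation.Binary.Permutation.Propositional using (_↭_)
open import Relation.Binary.PropositionalEquality using (_≡_)
open import Data.Product using (_×_)

Word : ℕ → Set
Word ν = Vec Bool ν

Array : ℕ → Set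
Array ν = List (Word ν)

weight : ∀ {n} → Word n → ℕ
weight [] = 0
weight (true ∷ w) = suc (weight w)
weight (false ∷ w) = weight w

allOnes : (ν : ℕ) → Word ν
allOnes ν = replicate ν true

occ : ∀ {ν} → Word ν → Array ν → ℕ
occ w A = length (filter (λ r → ≡-dec _≟ᵇ_ w r) A)

-- extraction of the columns selected by S (S is a characteristic vector of a set of columns)
extract : ∀ {ν} → Vec Bool ν → Word ν → List Bool
extract [] [] = []
extract (true ∷ S) (b ∷ w) = b ∷ extract S w
extract (false ∷ S) (b ∷ w) = extract S w

InΔ : (ν d k : ℕ) → Array ν → Array ν → Set
InΔ ν d k N D =
  (allOnes ν ∈ N)
  × All (λ r → weight r ≤ d) D
  × (∀ (S : Vec Bool ν) → weight S ≡ k → map (extract S) N ↭ map (extract S) D)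

Regular : ∀ {ν} → Array ν → Set
Regular {ν} A = ∀ (w w′ : Word ν) → weight w ≡ weight w′ → occ w A ≡ occ w′ A

RepVec : (ν d : ℕ) → (Fin (suc ν) → ℕ) → (Fin (suc d) → ℕ) → Array ν → Array ν → Set
RepVec ν d y x N D =
  (∀ (i : Fin (suc ν)) (w : Word ν) → weight w ≡ toℕ i → occ w N ≡ y i)
  × (∀ (i : Fin (suc d)) (w : Word ν) → weight w ≡ toℕ i → occ w D ≡ x i)

Σ[<_]_ : (n : ℕ) → (Fin n → ℕ) → ℕ
Σ[< n ] f = sum (map f (allFin n))

binomShift : ℕ → ℕ → ℕ → ℕ
binomShift n i h = if h ≤ᵇ i then n C (i ∸ h) else 0

-- Σ_{i=h}^{ν-k+h} C(ν-k, i-h) y_i   (terms outside the range vanish since the binomial is 0 there)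
lhsSum : (ν k h : ℕ) → (Fin (suc ν) → ℕ) → ℕ
lhsSum ν k h y = Σ[< suc ν ] (λ i → binomShift (ν ∸ k) (toℕ i) h * y i)

rhsSum : (ν d k h : ℕ) → (Fin (suc d) → ℕ) → ℕ
rhsSum ν d k h x = Σ[< suc d ] (λ i → binomShift (ν ∸ k) (toℕ i) h * x i)

totY : (ν : ℕ) → (Fin (suc ν) → ℕ) → ℕ
totY ν y = Σ[< suc ν ] (λ i → (ν C toℕ i) * y i)

totX : (ν d : ℕ) → (Fin (suc d) → ℕ) → ℕ
totX ν d x = Σ[< suc d ] (λ i → (ν C toℕ i) * x i)

{-# OPTIONS --safe #-}
module Submission where

-- If (y, x) represents (N, D), then up to the order of rows N (resp. D) is the
-- array in which every word w occurs ŷ (weight w) (resp. x̂ (weight w)) times,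
-- where ŷ and x̂ extend y and x by zeros.  In such an array the rows that
-- agree with a word u of length k on a set S of k columns are free on the
-- other ν − k columns, so on S the word u occurs Σⱼ C(ν − k, j) ŷ (weight u + j)
-- times.  The k-column condition of Δ(ν, d, k) is therefore exactly the system
-- of equations for h = weight u ∈ {0, …, k}, and the number of rows of N is
-- Σᵢ C(ν, i) yᵢ, the same computation for h = k = 0.

open import Defs
open import Data.Nat using (ℕ; suc; _+_; _*_; _≤_; _<_)
open import Data.Fin using (Fin; fromℕ)
open import Data.List using (length)
open import Data.Product using (_×_; ∃₂)
open import Function.Bundles using (_⇔_)
open import Relation.Binary.PropositionalEquality using (_≡_)

open import Data.Bool using (Bool; true; false; if_then_else_)
open import Data.Bool.Properties using () renaming (_≟_ to _≟ᵇ_)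
open import Data.Fin as Fin using (toℕ; fromℕ<)
open import Data.Fin.Properties using (toℕ-fromℕ; toℕ-fromℕ<)
open import Data.List using (List; []; _∷_; _++_; map; filter; replicate; tabulate)
open import Data.List.Membership.Propositional using (_∈_; _∉_)
open import Data.List.Membership.Propositional.Properties using (∈-∃++; ∈-map⁻)
open import Data.List.Properties
  using ( filter-++; filter-accept; length-++; length-map; length-replicate
        ; map-++; map-∘; map-replicate; map-tabulate)
open import Data.List.Relation.Binary.Permutation.Propositional using (_↭_; ↭-refl; ↭-sym; ↭-trans; prep)
open import Data.List.Relation.Binary.Permutation.Propositional.Properties
  using (All-resp-↭; ∈-resp-↭; filter-↭; map⁺; shift; ↭-length)
open import Data.List.Relation.Unary.All as All using (All)
open import Data.List.Relation.Unary.Any using (here; there; tail)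
open import Data.Nat using (zero; _∸_; z≤n; s≤s; _≟_; _≤?_)
open import Data.Nat.Combinatorics using (_C_; nCk+nC[k+1]≡[n+1]C[k+1])
open import Data.Nat.ListAction using (sum)
open import Data.Nat.Properties
open import Algebra.Properties.CommutativeSemigroup +-commutativeSemigroup
  using (interchange; x∙yz≈y∙xz)
open import Data.Product using (_,_; proj₁; proj₂)
open import Data.Vec as Vec using (Vec; []; _∷_; toList; fromList; cast)
open import Data.Vec.Properties using (toList-cast; toList∘fromList)
import Data.List.Properties as Listₚ
import Data.Vec.Properties as Vecₚ
open import Function using (_∘_; mk⇔; Equivalence)
open import Relation.Binary.Definitions using (DecidableEquality)
open import Relation.Binary.PropositionalEquality
  using (refl; sym; trans; cong; cong₂; subst; _≢_; _≗_; module ≡-Reasoning)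
open import Relation.Nullary using (yes; no; contradiction)

open ≡-Reasoning
open Equivalence using (to; from)

module Multiplicity {A : Set} (_≟ₐ_ : DecidableEquality A) where

  count : A → List A → ℕ
  count a = length ∘ filter (a ≟ₐ_)

  count-++ : ∀ a xs ys → count a (xs ++ ys) ≡ count a xs + count a ys
  count-++ a xs ys = trans (cong length (filter-++ (a ≟ₐ_) xs ys)) (length-++ (filter (a ≟ₐ_) xs))

  count-↭ : ∀ a {xs ys} → xs ↭ ys → count a xs ≡ count a ys
  count-↭ a xs↭ys = ↭-length (filter-↭ (a ≟ₐ_) xs↭ys)

  count-replicate : ∀ a n → count a (replicate n a) ≡ n
  count-replicate a zero    = refl
  count-replicate a (suc n) =
    trans (cong length (filter-accept (a ≟ₐ_) refl)) (cong suc (count-replicate a n))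

  ∈⇒count>0 : ∀ {a xs} → a ∈ xs → 0 < count a xs
  ∈⇒count>0 {a} {x ∷ xs} a∈ with a ≟ₐ x
  ... | yes _   = s≤s z≤n
  ... | no  a≢x = ∈⇒count>0 (tail a≢x a∈)

  count>0⇒∈ : ∀ {a} xs → 0 < count a xs → a ∈ xs
  count>0⇒∈ {a} (x ∷ xs) count>0 with a ≟ₐ x
  ... | yes refl = here refl
  ... | no  _    = there (count>0⇒∈ xs count>0)

  ∉⇒count≡0 : ∀ {a xs} → a ∉ xs → count a xs ≡ 0
  ∉⇒count≡0 {xs = xs} a∉xs = n≤0⇒n≡0 (≮⇒≥ (a∉xs ∘ count>0⇒∈ xs))

  count-∷-cancel : ∀ b x {xs ys} → count b (x ∷ xs) ≡ count b (x ∷ ys) → count b xs ≡ count b ys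
  count-∷-cancel b x eq with b ≟ₐ x
  ... | yes _ = suc-injective eq
  ... | no  _ = eq

  ≡count⇒↭ : ∀ xs ys → (∀ a → count a xs ≡ count a ys) → xs ↭ ys
  ≡count⇒↭ []       []       _  = ↭-refl
  ≡count⇒↭ []       (y ∷ ys) eq = contradiction (sym (eq y)) (n>0⇒n≢0 (∈⇒count>0 (here refl)))
  ≡count⇒↭ (x ∷ xs) ys       eq
    with l , r , refl ← ∈-∃++ (count>0⇒∈ ys (subst (0 <_) (eq x) (∈⇒count>0 (here refl))))
    = ↭-trans (prep x (≡count⇒↭ xs (l ++ r) eq′)) (↭-sym (shift x l r))
    where
    eq′ : ∀ b → count b xs ≡ count b (l ++ r)
    eq′ b = count-∷-cancel b x (trans (eq b) (count-↭ b (shift x l r)))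

module HeadSplit {A B : Set} (_≟A_ : DecidableEquality A) (_≟B_ : DecidableEquality B)
                 (_∷′_ : Bool → A → B)
                 (∷′-injective : ∀ {b c u v} → b ∷′ u ≡ c ∷′ v → b ≡ c × u ≡ v) where

  private
    module MA = Multiplicity _≟A_
    module MB = Multiplicity _≟B_

  count-map-∷′ : ∀ b u xs → MB.count (b ∷′ u) (map (b ∷′_) xs) ≡ MA.count u xs
  count-map-∷′ b u []       = refl
  count-map-∷′ b u (x ∷ xs) with u ≟A x | (b ∷′ u) ≟B (b ∷′ x)
  ... | yes refl | yes _ = cong suc (count-map-∷′ b u xs)
  ... | yes refl | no  b∷u≢b∷u = contradiction refl b∷u≢b∷u
  ... | no  u≢x  | yes eq = contradiction (proj₂ (∷′-injective eq)) u≢x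
  ... | no  _    | no  _  = count-map-∷′ b u xs

  count-map-other-∷′ : ∀ {b c} → b ≢ c → ∀ u xs → MB.count (b ∷′ u) (map (c ∷′_) xs) ≡ 0
  count-map-other-∷′ b≢c u xs = MB.∉⇒count≡0 {xs = map _ xs} λ b∷u∈ →
    let _ , _ , eq = ∈-map⁻ _ b∷u∈ in b≢c (proj₁ (∷′-injective eq))

  count-split : ∀ b u xs₁ xs₀ →
    MB.count (b ∷′ u) (map (true ∷′_) xs₁ ++ map (false ∷′_) xs₀) ≡ MA.count u (if b then xs₁ else xs₀)
  count-split true u xs₁ xs₀ = begin
    MB.count (true ∷′ u) (map (true ∷′_) xs₁ ++ map (false ∷′_) xs₀)
      ≡⟨ MB.count-++ _ (map (true ∷′_) xs₁) _ ⟩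
    MB.count (true ∷′ u) (map (true ∷′_) xs₁) + MB.count (true ∷′ u) (map (false ∷′_) xs₀)
      ≡⟨ cong₂ _+_ (count-map-∷′ true u xs₁) (count-map-other-∷′ (λ ()) u xs₀) ⟩
    MA.count u xs₁ + 0
      ≡⟨ +-identityʳ _ ⟩
    MA.count u xs₁ ∎
  count-split false u xs₁ xs₀ = begin
    MB.count (false ∷′ u) (map (true ∷′_) xs₁ ++ map (false ∷′_) xs₀)
      ≡⟨ MB.count-++ _ (map (true ∷′_) xs₁) _ ⟩
    MB.count (false ∷′ u) (map (true ∷′_) xs₁) + MB.count (false ∷′ u) (map (false ∷′_) xs₀)
      ≡⟨ cong₂ _+_ (count-map-other-∷′ (λ ()) u xs₁) (count-map-∷′ false u xs₀) ⟩
    MA.count u xs₀ ∎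

sumBelow : ℕ → (ℕ → ℕ) → ℕ
sumBelow zero    f = 0
sumBelow (suc n) f = f 0 + sumBelow n (f ∘ suc)

sumBelow-cong : ∀ n {f g : ℕ → ℕ} → f ≗ g → sumBelow n f ≡ sumBelow n g
sumBelow-cong zero    f≗g = refl
sumBelow-cong (suc n) f≗g = cong₂ _+_ (f≗g 0) (sumBelow-cong n (f≗g ∘ suc))

sumBelow-+ : ∀ n (f g : ℕ → ℕ) → sumBelow n (λ i → f i + g i) ≡ sumBelow n f + sumBelow n g
sumBelow-+ zero    f g = refl
sumBelow-+ (suc n) f g =
  trans (cong (f 0 + g 0 +_) (sumBelow-+ n (f ∘ suc) (g ∘ suc))) (interchange (f 0) (g 0) _ _)

sumBelow-vanishing : ∀ {n n′} (f : ℕ → ℕ) → n ≤ n′ → (∀ i → n ≤ i → f i ≡ 0) →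
                     sumBelow n′ f ≡ sumBelow n f
sumBelow-vanishing {n′ = zero}   f z≤n       f≡0 = refl
sumBelow-vanishing {n′ = suc n′} f z≤n       f≡0 =
  cong₂ _+_ (f≡0 0 z≤n) (sumBelow-vanishing {n′ = n′} (f ∘ suc) z≤n (λ i _ → f≡0 (suc i) z≤n))
sumBelow-vanishing               f (s≤s n≤n′) f≡0 =
  cong (f 0 +_) (sumBelow-vanishing (f ∘ suc) n≤n′ (λ i n≤i → f≡0 (suc i) (s≤s n≤i)))

-- Σⱼ C(m, j) z j (see sumBelow-binomial), defined by Pascal's rule since regularArray follows it.
binomialSum : ℕ → (ℕ → ℕ) → ℕ
binomialSum zero    z = z 0
binomialSum (suc m) z = binomialSum m (z ∘ suc) + binomialSum m z

binomialSum-cong : ∀ m {z z′ : ℕ → ℕ} → z ≗ z′ → binomialSum m z ≡ binomialSum m z′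
binomialSum-cong zero    z≗z′ = z≗z′ 0
binomialSum-cong (suc m) z≗z′ = cong₂ _+_ (binomialSum-cong m (z≗z′ ∘ suc)) (binomialSum-cong m z≗z′)

sumBelow-binomial : ∀ {m n} (z : ℕ → ℕ) → m < n → sumBelow n (λ j → (m C j) * z j) ≡ binomialSum m z
sumBelow-binomial {zero}  {suc n} z _ = begin
  1 * z 0 + sumBelow n (λ _ → 0)
    ≡⟨ cong₂ _+_ (*-identityˡ (z 0)) (sumBelow-vanishing {n′ = n} (λ _ → 0) z≤n (λ _ _ → refl)) ⟩
  z 0 + 0
    ≡⟨ +-identityʳ (z 0) ⟩
  z 0 ∎
sumBelow-binomial {suc m} {suc n} z (s≤s m<n) = begin
  1 * z 0 + sumBelow n (λ j → (suc m C suc j) * z (suc j))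
    ≡⟨ cong₂ _+_ (*-identityˡ (z 0)) (sumBelow-cong n pascal) ⟩
  z 0 + sumBelow n (λ j → (m C j) * z (suc j) + (m C suc j) * z (suc j))
    ≡⟨ cong (z 0 +_) (sumBelow-+ n _ _) ⟩
  z 0 + (Σ₀ + Σ₁)
    ≡⟨ x∙yz≈y∙xz (z 0) Σ₀ Σ₁ ⟩
  Σ₀ + (z 0 + Σ₁)
    ≡⟨ cong (λ t → Σ₀ + (t + Σ₁)) (sym (*-identityˡ (z 0))) ⟩
  Σ₀ + sumBelow (suc n) (λ j → (m C j) * z j)
    ≡⟨ cong₂ _+_ (sumBelow-binomial (z ∘ suc) m<n) (sumBelow-binomial z (m<n⇒m<1+n m<n)) ⟩
  binomialSum m (z ∘ suc) + binomialSum m z ∎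
  where
  Σ₀ Σ₁ : ℕ
  Σ₀ = sumBelow n (λ j → (m C j) * z (suc j))
  Σ₁ = sumBelow n (λ j → (m C suc j) * z (suc j))
  pascal : ∀ j → (suc m C suc j) * z (suc j) ≡ (m C j) * z (suc j) + (m C suc j) * z (suc j)
  pascal j = trans (cong (_* z (suc j)) (sym (nCk+nC[k+1]≡[n+1]C[k+1] m j)))
                   (*-distribʳ-+ (z (suc j)) (m C j) (m C suc j))

binomShift-suc : ∀ m i h → binomShift m (suc i) (suc h) ≡ binomShift m i h
binomShift-suc m i zero    = refl
binomShift-suc m i (suc h) = refl

sumBelow-binomShift : ∀ h n m (z : ℕ → ℕ) →
  sumBelow (h + n) (λ i → binomShift m i h * z i) ≡ sumBelow n (λ j → (m C j) * z (h + j))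
sumBelow-binomShift zero    n m z = refl
sumBelow-binomShift (suc h) n m z =
  trans (sumBelow-cong (h + n) (λ i → cong (_* z (suc i)) (binomShift-suc m i h)))
        (sumBelow-binomShift h n m (z ∘ suc))

extend : ∀ {n} → (Fin n → ℕ) → ℕ → ℕ
extend {zero}  f i       = 0
extend {suc n} f zero    = f Fin.zero
extend {suc n} f (suc i) = extend (f ∘ Fin.suc) i

extend-toℕ : ∀ {n} (f : Fin n → ℕ) i → extend f (toℕ i) ≡ f i
extend-toℕ f Fin.zero    = refl
extend-toℕ f (Fin.suc i) = extend-toℕ (f ∘ Fin.suc) i

extend-≥ : ∀ {n} (f : Fin n → ℕ) {i} → n ≤ i → extend f i ≡ 0
extend-≥ {zero}  f         _         = refl
extend-≥ {suc n} f {suc i} (s≤s n≤i) = extend-≥ (f ∘ Fin.suc) n≤i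

sum-tabulate≡sumBelow : ∀ {n} {f : Fin n → ℕ} {g : ℕ → ℕ} → (∀ i → f i ≡ g (toℕ i)) →
                        sum (tabulate f) ≡ sumBelow n g
sum-tabulate≡sumBelow {zero}  f≡g = refl
sum-tabulate≡sumBelow {suc n} f≡g = cong₂ _+_ (f≡g Fin.zero) (sum-tabulate≡sumBelow (f≡g ∘ Fin.suc))

Σ≡sumBelow : ∀ {n} {f : Fin n → ℕ} {g : ℕ → ℕ} → (∀ i → f i ≡ g (toℕ i)) → Σ[< n ] f ≡ sumBelow n g
Σ≡sumBelow {f = f} f≡g = trans (cong sum (map-tabulate (λ i → i) f)) (sum-tabulate≡sumBelow f≡g)

Σ-binomShift : ∀ {n} m h (f : Fin n → ℕ) →
  Σ[< n ] (λ i → binomShift m (toℕ i) h * f i) ≡ binomialSum m (λ j → extend f (h + j))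
Σ-binomShift {n} m h f = begin
  Σ[< n ] (λ i → binomShift m (toℕ i) h * f i)
    ≡⟨ Σ≡sumBelow (λ i → cong (binomShift m (toℕ i) h *_) (sym (extend-toℕ f i))) ⟩
  sumBelow n F
    ≡⟨ sumBelow-vanishing F n≤h+1+m+n F-vanishing ⟨
  sumBelow (h + suc (m + n)) F
    ≡⟨ sumBelow-binomShift h (suc (m + n)) m (extend f) ⟩
  sumBelow (suc (m + n)) (λ j → (m C j) * extend f (h + j))
    ≡⟨ sumBelow-binomial (λ j → extend f (h + j)) (s≤s (m≤m+n m n)) ⟩
  binomialSum m (λ j → extend f (h + j)) ∎
  where
  F : ℕ → ℕ
  F i = binomShift m i h * extend f i
  F-vanishing : ∀ i → n ≤ i → F i ≡ 0
  F-vanishing i n≤i = trans (cong (binomShift m i h *_) (extend-≥ f n≤i)) (*-zeroʳ (binomShift m i h))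
  n≤h+1+m+n : n ≤ h + suc (m + n)
  n≤h+1+m+n = ≤-trans (m≤n+m n (suc m)) (m≤n+m _ h)

_≟ʷ_ : ∀ {n} → DecidableEquality (Word n)
_≟ʷ_ = Vecₚ.≡-dec _≟ᵇ_

_≟ˡ_ : DecidableEquality (List Bool)
_≟ˡ_ = Listₚ.≡-dec _≟ᵇ_

-- Words.count is occ by definition.
module Words {n} = Multiplicity (_≟ʷ_ {n})
module Lists = Multiplicity _≟ˡ_
module WordSplit {n} = HeadSplit (_≟ʷ_ {n}) (_≟ʷ_ {suc n}) _∷_ Vecₚ.∷-injective
module ListSplit = HeadSplit _≟ˡ_ _≟ˡ_ _∷_ Listₚ.∷-injective

weight≤length : ∀ {n} (w : Word n) → weight w ≤ n
weight≤length []          = z≤n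
weight≤length (true ∷ w)  = s≤s (weight≤length w)
weight≤length (false ∷ w) = m≤n⇒m≤1+n (weight≤length w)

weight-allOnes : ∀ n → weight (allOnes n) ≡ n
weight-allOnes zero    = refl
weight-allOnes (suc n) = cong suc (weight-allOnes n)

wordOfWeight : ∀ {h n} → h ≤ n → Word n
wordOfWeight {n = n} z≤n       = Vec.replicate n false
wordOfWeight         (s≤s h≤n) = true ∷ wordOfWeight h≤n

weight-wordOfWeight : ∀ {h n} (h≤n : h ≤ n) → weight (wordOfWeight h≤n) ≡ h
weight-wordOfWeight {n = n} z≤n       = weight-zeros n
  where
  weight-zeros : ∀ n → weight (Vec.replicate n false) ≡ 0
  weight-zeros zero    = refl
  weight-zeros (suc n) = weight-zeros n
weight-wordOfWeight         (s≤s h≤n) = cong suc (weight-wordOfWeight h≤n)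

length-extract : ∀ {ν} (S : Vec Bool ν) (w : Word ν) → length (extract S w) ≡ weight S
length-extract []          []      = refl
length-extract (true ∷ S)  (_ ∷ w) = cong suc (length-extract S w)
length-extract (false ∷ S) (_ ∷ w) = length-extract S w

regularArray : (ν : ℕ) → (ℕ → ℕ) → Array ν
regularArray zero    z = replicate (z 0) []
regularArray (suc ν) z = map (true ∷_) (regularArray ν (z ∘ suc)) ++ map (false ∷_) (regularArray ν z)

occ-regularArray : ∀ {ν} (z : ℕ → ℕ) (w : Word ν) → occ w (regularArray ν z) ≡ z (weight w)
occ-regularArray z []          = Words.count-replicate [] (z 0)
occ-regularArray z (true ∷ w) =
  trans (WordSplit.count-split true w (regularArray _ (z ∘ suc)) (regularArray _ z))
        (occ-regularArray (z ∘ suc) w)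
occ-regularArray z (false ∷ w) =
  trans (WordSplit.count-split false w (regularArray _ (z ∘ suc)) (regularArray _ z))
        (occ-regularArray z w)

length-regularArray : ∀ ν (z : ℕ → ℕ) → length (regularArray ν z) ≡ binomialSum ν z
length-regularArray zero    z = length-replicate (z 0)
length-regularArray (suc ν) z = begin
  length (map (true ∷_) A₁ ++ map (false ∷_) A₀)
    ≡⟨ length-++ (map (true ∷_) A₁) ⟩
  length (map (true ∷_) A₁) + length (map (false ∷_) A₀)
    ≡⟨ cong₂ _+_ (length-map _ A₁) (length-map _ A₀) ⟩
  length A₁ + length A₀
    ≡⟨ cong₂ _+_ (length-regularArray ν (z ∘ suc)) (length-regularArray ν z) ⟩
  binomialSum ν (z ∘ suc) + binomialSum ν z ∎
  where
  A₁ A₀ : Array ν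
  A₁ = regularArray ν (z ∘ suc)
  A₀ = regularArray ν z

regularArray-regular : ∀ ν (z : ℕ → ℕ) → Regular (regularArray ν z)
regularArray-regular ν z w w′ eq =
  trans (occ-regularArray z w) (trans (cong z eq) (sym (occ-regularArray z w′)))

↭-regularArray : ∀ {ν} (A : Array ν) (z : ℕ → ℕ) → (∀ w → occ w A ≡ z (weight w)) → A ↭ regularArray ν z
↭-regularArray A z occ≡ = Words.≡count⇒↭ A _ (λ w → trans (occ≡ w) (sym (occ-regularArray z w)))

map-extract-false : ∀ {ν} (S : Vec Bool ν) (z : ℕ → ℕ) →
  map (extract (false ∷ S)) (regularArray (suc ν) z)
    ≡ map (extract S) (regularArray ν (z ∘ suc)) ++ map (extract S) (regularArray ν z)
map-extract-false {ν} S z =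
  trans (map-++ (extract (false ∷ S)) (map (true ∷_) A₁) _)
        (cong₂ _++_ (sym (map-∘ A₁)) (sym (map-∘ A₀)))
  where
  A₁ A₀ : Array ν
  A₁ = regularArray ν (z ∘ suc)
  A₀ = regularArray ν z

map-extract-true : ∀ {ν} (S : Vec Bool ν) (z : ℕ → ℕ) →
  map (extract (true ∷ S)) (regularArray (suc ν) z)
    ≡ map (true ∷_) (map (extract S) (regularArray ν (z ∘ suc)))
        ++ map (false ∷_) (map (extract S) (regularArray ν z))
map-extract-true {ν} S z =
  trans (map-++ (extract (true ∷ S)) (map (true ∷_) A₁) _)
        (cong₂ _++_ (trans (sym (map-∘ A₁)) (map-∘ A₁)) (trans (sym (map-∘ A₀)) (map-∘ A₀)))
  where
  A₁ A₀ : Array ν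
  A₁ = regularArray ν (z ∘ suc)
  A₀ = regularArray ν z

count-extract-regularArray : ∀ {ν} (S : Vec Bool ν) (u : Word (weight S)) (z : ℕ → ℕ) →
  Lists.count (toList u) (map (extract S) (regularArray ν z))
    ≡ binomialSum (ν ∸ weight S) (λ j → z (weight u + j))
count-extract-regularArray [] [] z =
  trans (cong (Lists.count []) (map-replicate (extract []) (z 0) [])) (Lists.count-replicate [] (z 0))
count-extract-regularArray {suc ν} (false ∷ S) u z = begin
  Lists.count (toList u) (map (extract (false ∷ S)) (regularArray (suc ν) z))
    ≡⟨ cong (Lists.count (toList u)) (map-extract-false S z) ⟩
  Lists.count (toList u) (map (extract S) A₁ ++ map (extract S) A₀)
    ≡⟨ Lists.count-++ (toList u) (map (extract S) A₁) _ ⟩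
  Lists.count (toList u) (map (extract S) A₁) + Lists.count (toList u) (map (extract S) A₀)
    ≡⟨ cong₂ _+_ (count-extract-regularArray S u (z ∘ suc)) (count-extract-regularArray S u z) ⟩
  binomialSum m (λ j → z (suc (weight u + j))) + binomialSum m (λ j → z (weight u + j))
    ≡⟨ cong (_+ binomialSum m (λ j → z (weight u + j)))
            (binomialSum-cong m (λ j → cong z (+-suc (weight u) j))) ⟨
  binomialSum (suc m) (λ j → z (weight u + j))
    ≡⟨ cong (λ n → binomialSum n (λ j → z (weight u + j))) (+-∸-assoc 1 (weight≤length S)) ⟨
  binomialSum (suc ν ∸ weight S) (λ j → z (weight u + j)) ∎
  where
  m : ℕ
  m = ν ∸ weight S
  A₁ A₀ : Array ν
  A₁ = regularArray ν (z ∘ suc)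
  A₀ = regularArray ν z
count-extract-regularArray {suc ν} (true ∷ S) (true ∷ u) z =
  trans (cong (Lists.count (true ∷ toList u)) (map-extract-true S z))
        (trans (ListSplit.count-split true (toList u) (map (extract S) (regularArray ν (z ∘ suc)))
                                      (map (extract S) (regularArray ν z)))
               (count-extract-regularArray S u (z ∘ suc)))
count-extract-regularArray {suc ν} (true ∷ S) (false ∷ u) z =
  trans (cong (Lists.count (false ∷ toList u)) (map-extract-true S z))
        (trans (ListSplit.count-split false (toList u) (map (extract S) (regularArray ν (z ∘ suc)))
                                       (map (extract S) (regularArray ν z)))
               (count-extract-regularArray S u z))

count-extract-wrongLength : ∀ {ν} (S : Vec Bool ν) (A : Array ν) u →
  length u ≢ weight S → Lists.count u (map (extract S) A) ≡ 0
count-extract-wrongLength S A u length≢ = Lists.∉⇒count≡0 {xs = map (extract S) A} λ u∈ →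
  let w , _ , u≡ = ∈-map⁻ (extract S) u∈ in length≢ (trans (cong length u≡) (length-extract S w))

BinomialEquations : ℕ → ℕ → (ℕ → ℕ) → (ℕ → ℕ) → Set
BinomialEquations ν k z z′ =
  ∀ h → h ≤ k → binomialSum (ν ∸ k) (λ j → z (h + j)) ≡ binomialSum (ν ∸ k) (λ j → z′ (h + j))

extract-regularArray-↭⇔ : ∀ {ν} (S : Vec Bool ν) (z z′ : ℕ → ℕ) →
  (map (extract S) (regularArray ν z) ↭ map (extract S) (regularArray ν z′))
    ⇔ BinomialEquations ν (weight S) z z′
extract-regularArray-↭⇔ {ν} S z z′ = mk⇔ equations ↭
  where
  EquationAt : ℕ → Set
  EquationAt h =
    binomialSum (ν ∸ weight S) (λ j → z (h + j)) ≡ binomialSum (ν ∸ weight S) (λ j → z′ (h + j))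

  equations : _ ↭ _ → BinomialEquations ν (weight S) z z′
  equations restrictions h h≤ =
    subst EquationAt (weight-wordOfWeight h≤)
          (trans (sym (count-extract-regularArray S u z))
                 (trans (Lists.count-↭ (toList u) restrictions) (count-extract-regularArray S u z′)))
    where
    u : Word (weight S)
    u = wordOfWeight h≤

  ↭ : BinomialEquations ν (weight S) z z′ → _ ↭ _
  ↭ eqs = Lists.≡count⇒↭ _ _ same-count
    where
    SameCount : List Bool → Set
    SameCount u = Lists.count u (map (extract S) (regularArray ν z))
                ≡ Lists.count u (map (extract S) (regularArray ν z′))

    same-count : ∀ u → SameCount u
    same-count u with length u ≟ weight S
    ... | no  length≢ = trans (count-extract-wrongLength S (regularArray ν z) u length≢)
                              (sym (count-extract-wrongLength S (regularArray ν z′) u length≢))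
    ... | yes length≡ =
      subst SameCount (trans (toList-cast length≡ (fromList u)) (toList∘fromList u))
            (trans (count-extract-regularArray S v z)
                   (trans (eqs (weight v) (weight≤length v)) (sym (count-extract-regularArray S v z′))))
      where
      v : Word (weight S)
      v = cast length≡ (fromList u)

restrictions⇔ : ∀ {ν k} → k ≤ ν → (z z′ : ℕ → ℕ) →
  (∀ (S : Vec Bool ν) → weight S ≡ k →
     map (extract S) (regularArray ν z) ↭ map (extract S) (regularArray ν z′))
    ⇔ BinomialEquations ν k z z′
restrictions⇔ {ν} {k} k≤ν z z′ = mk⇔
  (λ restrictions →
     subst Equations weight≡k (to (extract-regularArray-↭⇔ S z z′) (restrictions S weight≡k)))
  (λ eqs S′ weight′≡k → from (extract-regularArray-↭⇔ S′ z z′) (subst Equations (sym weight′≡k) eqs))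
  where
  Equations : ℕ → Set
  Equations k = BinomialEquations ν k z z′
  S : Vec Bool ν
  S = wordOfWeight k≤ν
  weight≡k : weight S ≡ k
  weight≡k = weight-wordOfWeight k≤ν

InΔ-resp-↭ : ∀ {ν d k} {N N′ D D′ : Array ν} → N ↭ N′ → D ↭ D′ → InΔ ν d k N D → InΔ ν d k N′ D′
InΔ-resp-↭ N↭N′ D↭D′ (allOnes∈N , D-bounded , restrictions) =
  ∈-resp-↭ N↭N′ allOnes∈N ,
  All-resp-↭ D↭D′ D-bounded ,
  λ S weight≡k →
    ↭-trans (↭-sym (map⁺ (extract S) N↭N′)) (↭-trans (restrictions S weight≡k) (map⁺ (extract S) D↭D′))

InΔ⇒length≡ : ∀ {ν d k} {N D : Array ν} → k ≤ ν → InΔ ν d k N D → length N ≡ length D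
InΔ⇒length≡ {N = N} {D} k≤ν (_ , _ , restrictions) = begin
  length N                  ≡⟨ length-map (extract S) N ⟨
  length (map (extract S) N) ≡⟨ ↭-length (restrictions S (weight-wordOfWeight k≤ν)) ⟩
  length (map (extract S) D) ≡⟨ length-map (extract S) D ⟩
  length D                  ∎
  where
  S : Vec Bool _
  S = wordOfWeight k≤ν

occ≡extend : ∀ {n ν} (f : Fin (suc n) → ℕ) (A : Array ν) →
  (∀ i w → weight w ≡ toℕ i → occ w A ≡ f i) → All (λ r → weight r ≤ n) A →
  ∀ w → occ w A ≡ extend f (weight w)
occ≡extend {n} f A occ≡f A-bounded w with weight w ≤? n
... | yes w≤n = begin
  occ w A             ≡⟨ occ≡f i w (sym (toℕ-fromℕ< (s≤s w≤n))) ⟩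
  f i                 ≡⟨ extend-toℕ f i ⟨
  extend f (toℕ i)    ≡⟨ cong (extend f) (toℕ-fromℕ< (s≤s w≤n)) ⟩
  extend f (weight w) ∎
  where
  i = fromℕ< (s≤s w≤n)
... | no  w≰n =
  trans (Words.∉⇒count≡0 {xs = A} (w≰n ∘ All.lookup A-bounded)) (sym (extend-≥ f (≰⇒> w≰n)))

module Representation {d ν} (y : Fin (suc ν) → ℕ) (x : Fin (suc d) → ℕ) where

  ŷ x̂ : ℕ → ℕ
  ŷ = extend y
  x̂ = extend x

  N₀ D₀ : Array ν
  N₀ = regularArray ν ŷ
  D₀ = regularArray ν x̂

  repVec : RepVec ν d y x N₀ D₀
  repVec = (λ i w weight≡i → trans (occ-regularArray ŷ w) (trans (cong ŷ weight≡i) (extend-toℕ y i))) ,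
           (λ i w weight≡i → trans (occ-regularArray x̂ w) (trans (cong x̂ weight≡i) (extend-toℕ x i)))

  weight-allOnes-fromℕ : weight (allOnes ν) ≡ toℕ (fromℕ ν)
  weight-allOnes-fromℕ = trans (weight-allOnes ν) (sym (toℕ-fromℕ ν))

  D₀-bounded : All (λ r → weight r ≤ d) D₀
  D₀-bounded = All.tabulate λ {r} r∈D₀ → ≮⇒≥ λ d<r →
    n>0⇒n≢0 (subst (0 <_) (occ-regularArray x̂ r) (Words.∈⇒count>0 r∈D₀)) (extend-≥ x d<r)

  ↭-canonical : ∀ {k N D} → InΔ ν d k N D → RepVec ν d y x N D → N ↭ N₀ × D ↭ D₀
  ↭-canonical {N = N} {D} (_ , D-bounded , _) (occN , occD) =
    ↭-regularArray N ŷ (occ≡extend y N occN (All.tabulate λ {r} _ → weight≤length r)) ,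
    ↭-regularArray D x̂ (occ≡extend x D occD D-bounded)

  equations⇔ : ∀ {k} → BinomialEquations ν k ŷ x̂ ⇔ (∀ h → h ≤ k → lhsSum ν k h y ≡ rhsSum ν d k h x)
  equations⇔ {k} = mk⇔
    (λ eqs h h≤k → trans (lhs h) (trans (eqs h h≤k) (sym (rhs h))))
    (λ eqs h h≤k → trans (sym (lhs h)) (trans (eqs h h≤k) (rhs h)))
    where
    lhs : ∀ h → lhsSum ν k h y ≡ binomialSum (ν ∸ k) (λ j → ŷ (h + j))
    lhs h = Σ-binomShift (ν ∸ k) h y
    rhs : ∀ h → rhsSum ν d k h x ≡ binomialSum (ν ∸ k) (λ j → x̂ (h + j))
    rhs h = Σ-binomShift (ν ∸ k) h x

  InΔ-canonical⇔ : ∀ {k} → k ≤ ν →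
    InΔ ν d k N₀ D₀ ⇔ (0 < y (fromℕ ν) × (∀ h → h ≤ k → lhsSum ν k h y ≡ rhsSum ν d k h x))
  InΔ-canonical⇔ k≤ν = mk⇔
    (λ (allOnes∈N₀ , _ , restrictions) →
       subst (0 <_) occ-allOnes (Words.∈⇒count>0 allOnes∈N₀) ,
       to equations⇔ (to (restrictions⇔ k≤ν ŷ x̂) restrictions))
    (λ (y>0 , eqs) →
       Words.count>0⇒∈ N₀ (subst (0 <_) (sym occ-allOnes) y>0) ,
       D₀-bounded ,
       from (restrictions⇔ k≤ν ŷ x̂) (from equations⇔ eqs))
    where
    occ-allOnes : occ (allOnes ν) N₀ ≡ y (fromℕ ν)
    occ-allOnes = proj₁ repVec (fromℕ ν) (allOnes ν) weight-allOnes-fromℕ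

  -- totY and totX are the case k = h = 0 of lhsSum and rhsSum, as binomShift m i 0 = C(m, i).
  length-N₀ : length N₀ ≡ totY ν y
  length-N₀ = trans (length-regularArray ν ŷ) (sym (Σ-binomShift ν 0 y))

  length-D₀ : length D₀ ≡ totX ν d x
  length-D₀ = trans (length-regularArray ν x̂) (sym (Σ-binomShift ν 0 x))

proposition3 : (k d ν : ℕ) → 1 ≤ k → k ≤ d → d ≤ ν →
  (y : Fin (suc ν) → ℕ) (x : Fin (suc d) → ℕ) →
  ((∃₂ λ (N D : Array ν) → InΔ ν d k N D × Regular N × Regular D × RepVec ν d y x N D)
    ⇔ (0 < y (fromℕ ν) × (∀ (h : ℕ) → h ≤ k → lhsSum ν k h y ≡ rhsSum ν d k h x)))
  × (∀ (N D : Array ν) → InΔ ν d k N D → Regular N → Regular D → RepVec ν d y x N D →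
      (occ (allOnes ν) N ≡ y (fromℕ ν))
      × (length D ≡ totY ν y)
      × (length D ≡ totX ν d x)
      × (2 * length D ≡ totY ν y + totX ν d x))
proposition3 k d ν _ k≤d d≤ν y x =
  mk⇔ (λ (N , D , inΔ , _ , _ , rep) →
         let N↭N₀ , D↭D₀ = ↭-canonical inΔ rep in to (InΔ-canonical⇔ k≤ν) (InΔ-resp-↭ N↭N₀ D↭D₀ inΔ))
      (λ conditions →
         N₀ , D₀ , from (InΔ-canonical⇔ k≤ν) conditions ,
         regularArray-regular ν ŷ , regularArray-regular ν x̂ , repVec) ,
  row-counts
  where
  open Representation y x

  k≤ν : k ≤ ν
  k≤ν = ≤-trans k≤d d≤ν

  row-counts : ∀ N D → InΔ ν d k N D → Regular N → Regular D → RepVec ν d y x N D →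
    (occ (allOnes ν) N ≡ y (fromℕ ν)) × (length D ≡ totY ν y) × (length D ≡ totX ν d x)
      × (2 * length D ≡ totY ν y + totX ν d x)
  row-counts N D inΔ _ _ rep =
    proj₁ rep (fromℕ ν) (allOnes ν) weight-allOnes-fromℕ , D≡totY , D≡totX ,
    trans (cong (length D +_) (+-identityʳ (length D))) (cong₂ _+_ D≡totY D≡totX)
    where
    D≡totY : length D ≡ totY ν y
    D≡totY = trans (sym (InΔ⇒length≡ k≤ν inΔ)) (trans (↭-length (proj₁ (↭-canonical inΔ rep))) length-N₀)
    D≡totX : length D ≡ totX ν d x
    D≡totX = trans (↭-length (proj₂ (↭-canonical inΔ rep))) length-D₀
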